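{- For every integer $n\ge 1$ and every integer $k$ with $0\le k\le 2n$, we have $s_{n,k}=z_{2n,k}$.
   Context: A 0-1-2 sum with $n$ summands is a sequence $(e_1,\dots,e_n)$ with each $e_i\in\{0,1,2\}$ such that whenever $e_i=2$ and $i<n$ we have $e_{i+1}\neq 0$. Its value is $e_1+\dots+e_n$. $s_{n,k}$ is the number of 0-1-2 sums with $n$ summands and value $k$. The fence $Z_{2n}$ is the directed graph with vertices $u_1,\dots,u_n$ and $v_1,\dots,v_n$. Its arcs are $u_i\to v_i$ for $1\le i\le n$ and $u_i\to v_{i+1}$ for $1\le i\le n-1$. A vertex set $A$ is closed if for every arc $x\to y$ with $x\in A$ we also have $y\in A$. $z_{2n,k}$ is the number of $k$-element closed sets of $Z_{2n}$. -}

module Defs where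

open import Data.Nat using (ℕ; zero; suc; _+_; _≡ᵇ_)
open import Data.Fin using (Fin; zero; suc; toℕ)
open import Data.Bool using (Bool; true; false; _∧_; _∨_; not; if_then_else_)
open import Data.Vec using (Vec; []; _∷_)
open import Data.List using (List; []; _∷_; map; concatMap; length; filter)
open import Data.Product using (_×_; _,_)
open import Relation.Nullary.Decidable using (yes; no)
open import Data.Bool.Properties using (T?)

allVecs : {A : Set} → List A → (n : ℕ) → List (Vec A n)
allVecs xs zero    = [] ∷ []
allVecs xs (suc n) = concatMap (λ x → map (x ∷_) (allVecs xs n)) xs

countᵇ : {A : Set} → (A → Bool) → List A → ℕ
countᵇ p xs = length (filter (λ x → T? (p x)) xs)

-- 0-1-2 sums: sequences (e₁,…,eₙ), eᵢ ∈ {0,1,2}, encoded as Fin 3,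
-- such that eᵢ = 2 and i < n imply eᵢ₊₁ ≠ 0.

digits : List (Fin 3)
digits = zero ∷ suc zero ∷ suc (suc zero) ∷ []

isTwo : Fin 3 → Bool
isTwo (suc (suc zero)) = true
isTwo _                = false

isZero : Fin 3 → Bool
isZero zero = true
isZero _    = false

valid012 : {n : ℕ} → Vec (Fin 3) n → Bool
valid012 []                = true
valid012 (e ∷ [])          = true
valid012 (e ∷ (f ∷ es))    =
  not (isTwo e ∧ isZero f) ∧ valid012 (f ∷ es)

value : {n : ℕ} → Vec (Fin 3) n → ℕ
value []       = 0
value (e ∷ es) = toℕ e + value es

s : ℕ → ℕ → ℕ
s n k = countᵇ (λ e → valid012 e ∧ (value e ≡ᵇ k)) (allVecs digits n)

-- The fence Z_{2n}: vertices u₁..uₙ, v₁..vₙ; arcs uᵢ → vᵢ (1 ≤ i ≤ n)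
-- and uᵢ → vᵢ₊₁ (1 ≤ i ≤ n-1).
-- A vertex set A is represented by a pair (a , b) of characteristic
-- vectors: a lists membership of u₁..uₙ, b lists membership of v₁..vₙ.

bools : List Bool
bools = false ∷ true ∷ []

_⇒ᵇ_ : Bool → Bool → Bool
x ⇒ᵇ y = not x ∨ y

-- closedness: for each arc x → y, x ∈ A implies y ∈ A.
-- Processed position by position: at position i, arc uᵢ → vᵢ,
-- and (if i < n) arc uᵢ → vᵢ₊₁.
closed : {n : ℕ} → Vec Bool n → Vec Bool n → Bool
closed []                []                  = true
closed (a ∷ [])          (b ∷ [])            = a ⇒ᵇ b
closed (a ∷ (a' ∷ as))   (b ∷ (b' ∷ bs))     =
  (a ⇒ᵇ b) ∧ (a ⇒ᵇ b') ∧ closed (a' ∷ as) (b' ∷ bs)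

ones : {n : ℕ} → Vec Bool n → ℕ
ones []           = 0
ones (true ∷ xs)  = suc (ones xs)
ones (false ∷ xs) = ones xs

allSubsets : (n : ℕ) → List (Vec Bool n × Vec Bool n)
allSubsets n = concatMap (λ a → map (a ,_) (allVecs bools n)) (allVecs bools n)

-- z (2n) k = number of k-element closed sets of Z_{2n}; indexed here by n
z2 : ℕ → ℕ → ℕ
z2 n k = countᵇ (λ { (a , b) → closed a b ∧ (ones a + ones b ≡ᵇ k) })
                (allSubsets n)

module Submission where

-- A 0-1-2 sum e = (e₁,…,eₙ) is the same thing as a closed set of the
-- fence Z₂ₙ: digit eᵢ decides the pair (uᵢ ∈ A , vᵢ ∈ A) by
--   0 ↦ (no , no),   1 ↦ (no , yes),   2 ↦ (yes , yes).
-- The arc uᵢ → vᵢ forbids exactly the fourth pair (yes , no), and the arc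
-- uᵢ → vᵢ₊₁ says "if eᵢ = 2 then eᵢ₊₁ ≠ 0", which is the 0-1-2 condition;
-- the size of the set is the value of the sum.

open import Defs
open import Data.Nat using (ℕ; _≤_; _*_)
open import Relation.Binary.PropositionalEquality using (_≡_)

open import Data.Nat using (zero; suc; _+_; _≡ᵇ_)
open import Data.Nat.Properties using (+-suc; +-identityʳ)
open import Data.Nat.Solver using (module +-*-Solver)
open import Data.Fin using (Fin; zero; suc)
open import Data.Bool using (Bool; true; false; _∧_; not)
open import Data.Bool.Properties using (∧-zeroʳ)
open import Data.Vec using (Vec; []; _∷_) renaming (map to vmap)
open import Data.List using (List; []; _∷_; map; concatMap; _++_)
open import Data.Product using (_×_; _,_)
open import Relation.Binary.PropositionalEquality using (refl; cong; cong₂; sym; trans; module ≡-Reasoning)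

open +-*-Solver using (solve; _:+_; con; _:=_)

𝟙 : Bool → ℕ
𝟙 true  = 1
𝟙 false = 0

sumOf : {A : Set} → (A → ℕ) → List A → ℕ
sumOf f []       = 0
sumOf f (x ∷ xs) = f x + sumOf f xs

count-as-sum : {A : Set} (p : A → Bool) (xs : List A) →
  countᵇ p xs ≡ sumOf (λ x → 𝟙 (p x)) xs
count-as-sum p [] = refl
count-as-sum p (x ∷ xs) with p x
... | true  = cong suc (count-as-sum p xs)
... | false = count-as-sum p xs

sumOf-cong : {A : Set} {f g : A → ℕ} (xs : List A) →
  (∀ x → f x ≡ g x) → sumOf f xs ≡ sumOf g xs
sumOf-cong []       f≗g = refl
sumOf-cong (x ∷ xs) f≗g = cong₂ _+_ (f≗g x) (sumOf-cong xs f≗g)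

sumOf-vanishing : {A : Set} {f : A → ℕ} (xs : List A) →
  (∀ x → f x ≡ 0) → sumOf f xs ≡ 0
sumOf-vanishing []       f≗0 = refl
sumOf-vanishing (x ∷ xs) f≗0 = cong₂ _+_ (f≗0 x) (sumOf-vanishing xs f≗0)

sumOf-+ : {A : Set} (f g : A → ℕ) (xs : List A) →
  sumOf (λ x → f x + g x) xs ≡ sumOf f xs + sumOf g xs
sumOf-+ f g [] = refl
sumOf-+ f g (x ∷ xs) = trans (cong (f x + g x +_) (sumOf-+ f g xs))
  (solve 4 (λ a b c d → (a :+ b) :+ (c :+ d) := (a :+ c) :+ (b :+ d)) refl
         (f x) (g x) (sumOf f xs) (sumOf g xs))

sumOf-++ : {A : Set} (f : A → ℕ) (xs ys : List A) →
  sumOf f (xs ++ ys) ≡ sumOf f xs + sumOf f ys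
sumOf-++ f []       ys = refl
sumOf-++ f (x ∷ xs) ys =
  trans (cong (f x +_) (sumOf-++ f xs ys))
        (solve 3 (λ a b c → a :+ (b :+ c) := (a :+ b) :+ c) refl (f x) (sumOf f xs) (sumOf f ys))

sumOf-map : {A B : Set} (f : B → ℕ) (g : A → B) (xs : List A) →
  sumOf f (map g xs) ≡ sumOf (λ x → f (g x)) xs
sumOf-map f g []       = refl
sumOf-map f g (x ∷ xs) = cong (f (g x) +_) (sumOf-map f g xs)

sumOf-concatMap : {A B : Set} (f : B → ℕ) (g : A → List B) (xs : List A) →
  sumOf f (concatMap g xs) ≡ sumOf (λ x → sumOf f (g x)) xs
sumOf-concatMap f g []       = refl
sumOf-concatMap f g (x ∷ xs) =
  trans (sumOf-++ f (g x) (concatMap g xs)) (cong (sumOf f (g x) +_) (sumOf-concatMap f g xs))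

sumOf-swap : {A B : Set} (h : A → B → ℕ) (xs : List A) (ys : List B) →
  sumOf (λ x → sumOf (h x) ys) xs ≡ sumOf (λ y → sumOf (λ x → h x y) xs) ys
sumOf-swap h []       ys = sym (sumOf-vanishing ys (λ _ → refl))
sumOf-swap h (x ∷ xs) ys =
  trans (cong (sumOf (h x) ys +_) (sumOf-swap h xs ys))
        (sym (sumOf-+ (h x) (λ y → sumOf (λ x′ → h x′ y) xs) ys))

sumOf-allVecs-suc : {A : Set} (xs : List A) (n : ℕ) (f : Vec A (suc n) → ℕ) →
  sumOf f (allVecs xs (suc n)) ≡ sumOf (λ x → sumOf (λ v → f (x ∷ v)) (allVecs xs n)) xs
sumOf-allVecs-suc xs n f =
  trans (sumOf-concatMap f (λ x → map (x ∷_) (allVecs xs n)) xs)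
        (sumOf-cong xs (λ x → sumOf-map f (x ∷_) (allVecs xs n)))

count-product : {A B : Set} (p : A × B → Bool) (xs : List A) (ys : List B) →
  countᵇ p (concatMap (λ x → map (x ,_) ys) xs) ≡ sumOf (λ x → sumOf (λ y → 𝟙 (p (x , y))) ys) xs
count-product p xs ys =
  trans (count-as-sum p (concatMap (λ x → map (x ,_) ys) xs))
  (trans (sumOf-concatMap (λ q → 𝟙 (p q)) (λ x → map (x ,_) ys) xs)
         (sumOf-cong xs (λ x → sumOf-map (λ q → 𝟙 (p q)) (x ,_) ys)))

upper lower : Fin 3 → Bool
upper d = isTwo d
lower d = not (isZero d)

U L : {n : ℕ} → Vec (Fin 3) n → Vec Bool n
U = vmap upper
L = vmap lower

-- The encoding of a 0-1-2 sum is closed exactly when the sum is valid: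
-- uᵢ → vᵢ always holds, and uᵢ → vᵢ₊₁ is the condition on eᵢ₊₁.
closed-encoding : {n : ℕ} (e : Vec (Fin 3) n) → closed (U e) (L e) ≡ valid012 e
closed-encoding []                               = refl
closed-encoding (zero ∷ [])                      = refl
closed-encoding (suc zero ∷ [])                  = refl
closed-encoding (suc (suc zero) ∷ [])            = refl
closed-encoding (zero ∷ f ∷ e)                   = closed-encoding (f ∷ e)
closed-encoding (suc zero ∷ f ∷ e)               = closed-encoding (f ∷ e)
closed-encoding (suc (suc zero) ∷ f ∷ e)         = cong (lower f ∧_) (closed-encoding (f ∷ e))

size-encoding : {n : ℕ} (e : Vec (Fin 3) n) → ones (U e) + ones (L e) ≡ value e
size-encoding []                     = refl
size-encoding (zero ∷ e)             = size-encoding e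
size-encoding (suc zero ∷ e)         = trans (+-suc (ones (U e)) (ones (L e))) (cong suc (size-encoding e))
size-encoding (suc (suc zero) ∷ e)   =
  cong suc (trans (+-suc (ones (U e)) (ones (L e))) (cong suc (size-encoding e)))

data Crossing : {n : ℕ} → Vec Bool n → Vec Bool n → Set where
  here  : {n : ℕ} {a b : Vec Bool n} → Crossing (true ∷ a) (false ∷ b)
  there : {n : ℕ} {x y : Bool} {a b : Vec Bool n} → Crossing a b → Crossing (x ∷ a) (y ∷ b)

crossing-not-closed : {n : ℕ} {a b : Vec Bool n} → Crossing a b → closed a b ≡ false
crossing-not-closed {a = true ∷ []}    {b = false ∷ []}    here = refl
crossing-not-closed {a = true ∷ _ ∷ _} {b = false ∷ _ ∷ _} here = refl
crossing-not-closed {a = x ∷ a′ ∷ a} {b = y ∷ b′ ∷ b} (there c) =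
  trans (cong (λ t → (x ⇒ᵇ y) ∧ ((x ⇒ᵇ b′) ∧ t)) (crossing-not-closed c))
        (trans (cong ((x ⇒ᵇ y) ∧_) (∧-zeroʳ (x ⇒ᵇ b′))) (∧-zeroʳ (x ⇒ᵇ y)))

-- Summing over all pairs of subsets a function that vanishes on pairs with
-- a crossing is the same as summing over all digit vectors at the encoding:
-- per position, the pairs without crossing are exactly the three encodings.
sum-over-subset-pairs : (n : ℕ) (f : Vec Bool n → Vec Bool n → ℕ) →
  (∀ {a b} → Crossing a b → f a b ≡ 0) →
  sumOf (λ a → sumOf (f a) (allVecs bools n)) (allVecs bools n)
    ≡ sumOf (λ e → f (U e) (L e)) (allVecs digits n)
sum-over-subset-pairs zero    f vanish = +-identityʳ (f [] [] + 0)
sum-over-subset-pairs (suc n) f vanish = begin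
  sumOf (λ a → sumOf (f a) (allVecs bools (suc n))) (allVecs bools (suc n))
    ≡⟨ sumOf-cong (allVecs bools (suc n)) (λ a → sumOf-allVecs-suc bools n (f a)) ⟩
  sumOf (λ a → sumOf (λ y → sumOf (λ b → f a (y ∷ b)) W) bools) (allVecs bools (suc n))
    ≡⟨ sumOf-allVecs-suc bools n _ ⟩
  sumOf (λ x → sumOf (λ a → sumOf (λ y → sumOf (λ b → f (x ∷ a) (y ∷ b)) W) bools) W) bools
    ≡⟨ sumOf-cong bools (λ x → sumOf-swap (λ a y → sumOf (λ b → f (x ∷ a) (y ∷ b)) W) W bools) ⟩
  (block false false + (block false true + 0)) + ((block true false + (block true true + 0)) + 0)
    ≡⟨ cong₂ _+_ (cong₂ _+_ (reduce false false) (cong (_+ 0) (reduce false true)))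
                 (cong (_+ 0) (cong₂ _+_ no-crossing-block (cong (_+ 0) (reduce true true)))) ⟩
  (digit zero + (digit (suc zero) + 0)) + ((0 + (digit (suc (suc zero)) + 0)) + 0)
    ≡⟨ solve 3 (λ p q r → (p :+ (q :+ con 0)) :+ ((con 0 :+ (r :+ con 0)) :+ con 0)
                        := p :+ (q :+ (r :+ con 0))) refl
             (digit zero) (digit (suc zero)) (digit (suc (suc zero))) ⟩
  sumOf digit digits
    ≡⟨ sym (sumOf-allVecs-suc digits n (λ e → f (U e) (L e))) ⟩
  sumOf (λ e → f (U e) (L e)) (allVecs digits (suc n)) ∎
  where
  open ≡-Reasoning
  W = allVecs bools n
  block : Bool → Bool → ℕ
  block x y = sumOf (λ a → sumOf (λ b → f (x ∷ a) (y ∷ b)) W) W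
  digit : Fin 3 → ℕ
  digit d = sumOf (λ e → f (upper d ∷ U e) (lower d ∷ L e)) (allVecs digits n)
  reduce : ∀ x y → block x y ≡ sumOf (λ e → f (x ∷ U e) (y ∷ L e)) (allVecs digits n)
  reduce x y = sum-over-subset-pairs n (λ a b → f (x ∷ a) (y ∷ b)) (λ c → vanish (there c))
  no-crossing-block : block true false ≡ 0
  no-crossing-block = sumOf-vanishing W (λ a → sumOf-vanishing W (λ b → vanish here))

-- The identity holds for all n and k.
theorem4 : (n k : ℕ) → 1 ≤ n → k ≤ 2 * n → s n k ≡ z2 n k
theorem4 n k _ _ = begin
  s n k
    ≡⟨ count-as-sum _ (allVecs digits n) ⟩
  sumOf (λ e → 𝟙 (valid012 e ∧ (value e ≡ᵇ k))) (allVecs digits n)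
    ≡⟨ sumOf-cong (allVecs digits n) (λ e →
         sym (cong₂ (λ c m → 𝟙 (c ∧ (m ≡ᵇ k))) (closed-encoding e) (size-encoding e))) ⟩
  sumOf (λ e → closedOfSize (U e) (L e)) (allVecs digits n)
    ≡⟨ sym (sum-over-subset-pairs n closedOfSize
              (λ {a} {b} c → cong (λ t → 𝟙 (t ∧ (ones a + ones b ≡ᵇ k)))
                                       (crossing-not-closed c))) ⟩
  sumOf (λ a → sumOf (closedOfSize a) (allVecs bools n)) (allVecs bools n)
    ≡⟨ sym (count-product _ (allVecs bools n) (allVecs bools n)) ⟩
  z2 n k ∎
  where
  open ≡-Reasoning
  closedOfSize : Vec Bool n → Vec Bool n → ℕ
  closedOfSize a b = 𝟙 (closed a b ∧ (ones a + ones b ≡ᵇ k))
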